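{- Let $G=(V,E)$ be a graph, let $X,Y\subseteq V$ and $k\in\mathbb{N}$. Every leftmost $(X,Y,\leq k)^G$-separator is an important $(X,Y,\leq k)^G$-separator. The converse does not hold in general: there exist $G$, $X$, $Y$, $k$ and an important $(X,Y,\leq k)^G$-separator that is not a leftmost $(X,Y,\leq k)^G$-separator.
   Context: A set $S\subseteq V$ is an $(X,Y)^G$-separator if $G-S$ (the subgraph induced on $V\setminus S$) contains no path from a vertex of $X$ to a vertex of $Y$ ($X$, $Y$, $S$ may intersect). For such $S$, $V_{X,S}$ denotes the set of vertices of $G-S$ reachable by a path in $G-S$ from $X\setminus S$, and $V_{S,Y}$ the set of vertices of $G-S$ reachable from $Y\setminus S$. A separator is minimal if no proper subset is an $(X,Y)^G$-separator. Write $S\preceq S'$ if $V_{X,S}\subseteq V_{X,S'}$. An $(X,Y,\leq k)^G$-separator is an $(X,Y)^G$-separator of size at most $k$. A separator $S$ is a leftmost $(X,Y,\leq k)^G$-separator if it is a minimal $(X,Y,\leq k)^G$-separator and there is no other minimal $(X,Y,\leq k)^G$-separator $S'\neq S$ with $S'\preceq S$. A separator $S'$ dominates $S$ if $|S'|\leq |S|$ and $V_{S,Y}\subsetneq V_{S',Y}$. A separator $S$ is an important $(X,Y,\leq k)^G$-separator if it is a minimal $(X,Y,\leq k)^G$-separator and no other minimal $(X,Y,\leq k)^G$-separator dominates $S$. -}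

module Defs where

open import Data.Nat using (ℕ; _≤_)
open import Data.Bool using (Bool; true; false)
open import Data.Fin using (Fin)
open import Data.Fin.Subset using (Subset; _∈_; _∉_; _⊂_; ∣_∣)
open import Data.Product using (Σ; _×_; ∃)
open import Relation.Binary.PropositionalEquality using (_≡_; _≢_)
open import Relation.Nullary using (¬_)

record Graph : Set where
  field
    n     : ℕ
    adj   : Fin n → Fin n → Bool
    sym   : ∀ u v → adj u v ≡ adj v u
    irref : ∀ v → adj v v ≡ false

open Graph public

module _ (G : Graph) where

  V : Set
  V = Fin (n G)

  data PathAvoid (S : Subset (n G)) : V → V → Set where
    here  : ∀ {v} → v ∉ S → PathAvoid S v v
    step  : ∀ {u w v} → u ∉ S → adj G u w ≡ true → PathAvoid S w v → PathAvoid S u v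

  IsSep : Subset (n G) → Subset (n G) → Subset (n G) → Set
  IsSep X Y S = ∀ x y → x ∈ X → y ∈ Y → ¬ PathAvoid S x y

  VXS : Subset (n G) → Subset (n G) → V → Set
  VXS X S v = Σ V λ x → x ∈ X × PathAvoid S x v

  VSY : Subset (n G) → Subset (n G) → V → Set
  VSY S Y v = Σ V λ y → y ∈ Y × PathAvoid S y v

  _⊆ₚ_ : (V → Set) → (V → Set) → Set
  A ⊆ₚ B = ∀ v → A v → B v

  _⊊ₚ_ : (V → Set) → (V → Set) → Set
  A ⊊ₚ B = (A ⊆ₚ B) × ¬ (B ⊆ₚ A)

  IsMinSep : Subset (n G) → Subset (n G) → Subset (n G) → Set
  IsMinSep X Y S = IsSep X Y S × (∀ S' → S' ⊂ S → ¬ IsSep X Y S')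

  IsMinSepk : Subset (n G) → Subset (n G) → ℕ → Subset (n G) → Set
  IsMinSepk X Y k S = IsMinSep X Y S × ∣ S ∣ ≤ k

  Preceq : Subset (n G) → Subset (n G) → Subset (n G) → Set
  Preceq X S S' = VXS X S ⊆ₚ VXS X S'

  IsLeftmost : Subset (n G) → Subset (n G) → ℕ → Subset (n G) → Set
  IsLeftmost X Y k S =
    IsMinSepk X Y k S × (∀ S' → IsMinSepk X Y k S' → S' ≢ S → ¬ Preceq X S' S)

  Dominates : Subset (n G) → Subset (n G) → Subset (n G) → Set
  Dominates Y S' S = (∣ S' ∣ ≤ ∣ S ∣) × (VSY S Y ⊊ₚ VSY S' Y)

  IsImportant : Subset (n G) → Subset (n G) → ℕ → Subset (n G) → Set
  IsImportant X Y k S =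
    IsMinSepk X Y k S × (∀ S' → IsMinSepk X Y k S' → S' ≢ S → ¬ Dominates Y S' S)

-- Let S be leftmost and let S' dominate S. Every vertex u that G - S' reaches
-- from X lies outside S: otherwise S - u would still separate X from Y, since a
-- path through u that first leaves S afterwards ends in V_{S,Y} ⊆ V_{S',Y},
-- which would join X to Y in G - S'. Hence V_{X,S'} ⊆ V_{X,S}, i.e. S' ⪯ S,
-- contradicting leftmostness. For the converse,
-- in the path 0 - 2 - 1 with X = {0, 1}, Y = {2} and k = 2, the set {2} is the
-- only separator of size at most 1, hence important, while X itself is a
-- minimal separator with V_{X,X} = ∅.
module Submission where

open import Defs
open import Data.Nat using (ℕ; _≤_; z≤n; s≤s)
open import Data.Nat.Properties using (<⇒≤)
open import Data.Bool using (Bool; true; false; _xor_)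
open import Data.Bool.Properties using (xor-comm; xor-same)
open import Data.Fin using (Fin; zero; suc; _≟_)
open import Data.Fin.Subset using (Subset; _∈_; _∉_; _-_; ⁅_⁆; ∣_∣; inside; outside)
open import Data.Fin.Subset.Properties
  using (_∈?_; x∈⁅x⁆; x∈p∧x≢y⇒x∈p-y; x∈p⇒p-x⊂p; p⊂q⇒∣p∣<∣q∣)
open import Data.Vec using ([]; _∷_; here; there)
open import Data.Product using (Σ; _×_; _,_; proj₁)
open import Data.Sum using (_⊎_; inj₁; inj₂)
open import Data.Empty using (⊥-elim)
open import Relation.Nullary using (¬_; yes; no)
open import Relation.Nullary.Decidable using (decidable-stable)
open import Relation.Binary.PropositionalEquality using (_≡_; refl; trans; subst)

x∈p∧x∉p-y⇒x≡y : ∀ {m} {x y : Fin m} {p : Subset m} → x ∈ p → x ∉ p - y → x ≡ y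
x∈p∧x∉p-y⇒x≡y {x = x} {y} x∈p x∉p-y =
  decidable-stable (x ≟ y) (λ x≢y → x∉p-y (x∈p∧x≢y⇒x∈p-y x∈p x≢y))

module _ (G : Graph) where

  private variable
    S S' X Y : Subset (n G)
    a b c u : V G

  private
    _⊆_ : (V G → Set) → (V G → Set) → Set
    _⊆_ = _⊆ₚ_ G

  adj-sym : adj G a b ≡ true → adj G b a ≡ true
  adj-sym {a} {b} e = trans (Graph.sym G b a) e

  source∉ : PathAvoid G S a b → a ∉ S
  source∉ (here a∉S)     = a∉S
  source∉ (step a∉S _ _) = a∉S

  target∉ : PathAvoid G S a b → b ∉ S
  target∉ (here b∉S)   = b∉S
  target∉ (step _ _ P) = target∉ P

  snoc : PathAvoid G S a b → adj G b c ≡ true → c ∉ S → PathAvoid G S a c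
  snoc (here a∉S)      e c∉S = step a∉S e (here c∉S)
  snoc (step a∉S e′ P) e c∉S = step a∉S e′ (snoc P e c∉S)

  _++_ : PathAvoid G S a b → PathAvoid G S b c → PathAvoid G S a c
  here _       ++ Q = Q
  step a∉S e P ++ Q = step a∉S e (P ++ Q)

  reverse : PathAvoid G S a b → PathAvoid G S b a
  reverse (here a∉S)     = here a∉S
  reverse (step a∉S e P) = snoc (reverse P) (adj-sym e) a∉S

  PathAvoid-transfer : ∀ {S S' a b} → (∀ {w} → PathAvoid G S' a w → w ∉ S) →
                       PathAvoid G S' a b → PathAvoid G S a b
  PathAvoid-transfer {S} {S'} {a} off P = go (here (source∉ P)) P
    where
    go : PathAvoid G S' a u → PathAvoid G S' u b → PathAvoid G S u b
    go R (here _)     = here (off R)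
    go R (step _ e P) = step (off R) e (go (snoc R e (source∉ P)) P)

  source-isSep : IsSep G X Y X
  source-isSep x y x∈X _ P = source∉ P x∈X

  target-isSep : IsSep G X Y Y
  target-isSep x y _ y∈Y P = target∉ P y∈Y

  source-⪯ : Preceq G X X S
  source-⪯ v (x , x∈X , P) = ⊥-elim (source∉ P x∈X)

  adjacent⇒¬IsSep : ∀ {x y} → x ∈ X → y ∈ Y → adj G x y ≡ true →
                    x ∉ S → y ∉ S → ¬ IsSep G X Y S
  adjacent⇒¬IsSep x∈X y∈Y e x∉S y∉S sep = sep _ _ x∈X y∈Y (step x∉S e (here y∉S))

  -- A path of G - (S - u) ending in Y either avoids S, or its final visit of u
  -- is followed by a path of G - S into Y, which the hypothesis moves into G - S'.
  avoid-or-reach : VSY G S Y ⊆ VSY G S' Y → u ∉ S' → ∀ {y} → y ∈ Y →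
                   PathAvoid G (S - u) a y → PathAvoid G S a y ⊎ VSY G S' Y u
  avoid-or-reach {S = S} sub u∉S' y∈Y (here {a} a∉S-u) with a ∈? S
  ... | no a∉S = inj₁ (here a∉S)
  ... | yes a∈S with x∈p∧x∉p-y⇒x≡y a∈S a∉S-u
  ... | refl = inj₂ (_ , y∈Y , here u∉S')
  avoid-or-reach {S = S} sub u∉S' y∈Y (step {a} {w} a∉S-u e P)
    with avoid-or-reach sub u∉S' y∈Y P
  ... | inj₂ u∈VSY = inj₂ u∈VSY
  ... | inj₁ Q with a ∈? S
  ... | no a∉S = inj₁ (step a∉S e Q)
  ... | yes a∈S with x∈p∧x∉p-y⇒x≡y a∈S a∉S-u
  ... | refl with sub w (_ , y∈Y , reverse Q)
  ... | y′ , y′∈Y , T = inj₂ (y′ , y′∈Y , snoc T (adj-sym e) u∉S')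

  reachable⇒∉minSep : IsMinSep G X Y S → IsSep G X Y S' → VSY G S Y ⊆ VSY G S' Y →
                      ∀ {x} → x ∈ X → PathAvoid G S' x u → u ∉ S
  reachable⇒∉minSep {X = X} {Y = Y} {S = S} {u = u} (sep , minimal) sep′ sub {x} x∈X R u∈S =
    minimal (S - u) (x∈p⇒p-x⊂p u∈S) sep-u
    where
    sep-u : IsSep G X Y (S - u)
    sep-u x′ y x′∈X y∈Y P with avoid-or-reach sub (target∉ R) y∈Y P
    ... | inj₁ Q                = sep x′ y x′∈X y∈Y Q
    ... | inj₂ (y′ , y′∈Y , T) = sep′ x y′ x∈X y′∈Y (R ++ reverse T)

  VSY⊆⇒⪯ : IsMinSep G X Y S → IsSep G X Y S' → VSY G S Y ⊆ VSY G S' Y → Preceq G X S' S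
  VSY⊆⇒⪯ min sep′ sub v (x , x∈X , P) =
    x , x∈X , PathAvoid-transfer (reachable⇒∉minSep min sep′ sub x∈X) P

  leftmost⇒important : ∀ {k} → IsLeftmost G X Y k S → IsImportant G X Y k S
  leftmost⇒important (minₖ , leftmost) = minₖ , λ where
    S' minₖ′ S'≢S (_ , sub , _) →
      leftmost S' minₖ′ S'≢S (VSY⊆⇒⪯ (proj₁ minₖ) (proj₁ (proj₁ minₖ′)) sub)

centre : Fin 3
centre = suc (suc zero)

isCentre : Fin 3 → Bool
isCentre (suc (suc zero)) = true
isCentre _                = false

cherry : Graph
cherry = record
  { n     = 3
  ; adj   = λ u v → isCentre u xor isCentre v
  ; sym   = λ u v → xor-comm (isCentre u) (isCentre v)
  ; irref = λ v → xor-same (isCentre v)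
  }

leaves : Subset 3
leaves = inside ∷ inside ∷ outside ∷ []

centre∉leaves : centre ∉ leaves
centre∉leaves (there (there ()))

leaf-adj-centre : ∀ {l} → l ∈ leaves → adj cherry l centre ≡ true
leaf-adj-centre here         = refl
leaf-adj-centre (there here) = refl
leaf-adj-centre (there (there (there ())))

small-sep≡centre : ∀ T → IsSep cherry leaves ⁅ centre ⁆ T → ∣ T ∣ ≤ 1 → T ≡ ⁅ centre ⁆
small-sep≡centre (outside ∷ outside ∷ inside ∷ [])  _   _ = refl
small-sep≡centre (outside ∷ inside  ∷ inside ∷ [])  _   (s≤s ())
small-sep≡centre (inside  ∷ outside ∷ inside ∷ [])  _   (s≤s ())
small-sep≡centre (inside  ∷ inside  ∷ inside ∷ [])  _   (s≤s ())
small-sep≡centre (inside  ∷ inside  ∷ outside ∷ []) _   (s≤s ())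
small-sep≡centre (outside ∷ _ ∷ outside ∷ [])       sep _ = ⊥-elim
  (adjacent⇒¬IsSep cherry here (x∈⁅x⁆ centre) refl (λ ()) (λ { (there (there ())) }) sep)
small-sep≡centre (inside ∷ outside ∷ outside ∷ [])  sep _ = ⊥-elim
  (adjacent⇒¬IsSep cherry (there here) (x∈⁅x⁆ centre) refl (λ { (there ()) }) (λ { (there (there ())) }) sep)

centre-minSep : IsMinSep cherry leaves ⁅ centre ⁆ ⁅ centre ⁆
centre-minSep = target-isSep cherry , λ where
  T T⊂@(_ , z , z∈centre , z∉T) sepT →
    subst (z ∉_) (small-sep≡centre T sepT (<⇒≤ (p⊂q⇒∣p∣<∣q∣ T⊂))) z∉T z∈centre

leaves-minSep : IsMinSep cherry leaves ⁅ centre ⁆ leaves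
leaves-minSep = source-isSep cherry , λ where
  T (T⊆leaves , l , l∈leaves , l∉T) →
    adjacent⇒¬IsSep cherry l∈leaves (x∈⁅x⁆ centre) (leaf-adj-centre l∈leaves) l∉T
      (λ centre∈T → centre∉leaves (T⊆leaves centre∈T))

centre-important : IsImportant cherry leaves ⁅ centre ⁆ 2 ⁅ centre ⁆
centre-important = (centre-minSep , s≤s z≤n) , λ where
  T ((sepT , _) , _) T≢centre (∣T∣≤1 , _) → T≢centre (small-sep≡centre T sepT ∣T∣≤1)

centre-¬leftmost : ¬ IsLeftmost cherry leaves ⁅ centre ⁆ 2 ⁅ centre ⁆
centre-¬leftmost (_ , leftmost) =
  leftmost leaves (leaves-minSep , s≤s (s≤s z≤n)) (λ ()) (source-⪯ cherry)

lemma1 : ((G : Graph) (X Y : Subset (n G)) (k : ℕ) (S : Subset (n G))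
            → IsLeftmost G X Y k S → IsImportant G X Y k S)
         × Σ Graph (λ G → Σ (Subset (n G)) (λ X → Σ (Subset (n G)) (λ Y →
             Σ ℕ (λ k → Σ (Subset (n G)) (λ S →
               IsImportant G X Y k S × ¬ IsLeftmost G X Y k S)))))
lemma1 = (λ G X Y k S → leftmost⇒important G)
       , cherry , leaves , ⁅ centre ⁆ , 2 , ⁅ centre ⁆ , centre-important , centre-¬leftmost
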